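{- Let $\Gamma$ be a $4$-regular infinite planar tessellation with non-negative combinatorial curvature, and let $\sigma_1\ne\sigma_2$ be faces of degrees $k_1,k_2\ge 8$. Assume there are two triangles $\tau$ and $\omega$ such that $\tau$ is lower-adjacent to $\sigma_1$, $\omega$ is lower-adjacent to $\sigma_2$, and $\partial\tau\setminus\partial\sigma_1=\partial\omega\setminus\partial\sigma_2$. Then one of the following holds: (1) there exists a square $\omega_1$ such that $\omega_1$ is $\sigma_1$-adjacent to $\tau$ and $\omega_1$ is $\sigma_2$-adjacent to $\omega$; (2) there exist two triangles $\tau_1,\omega_1$ with $\tau_1$ $\sigma_1$-adjacent to $\tau$ and $\omega_1$ $\sigma_2$-adjacent to $\omega$, such that $(\partial\tau_1\setminus\partial\sigma_1)\cap(\partial\omega_1\setminus\partial\sigma_2)\ne\emptyset$.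
   Context: A planar tessellation is a locally finite, connected, simple graph embedded in $\mathbb S^2$ or $\mathbb R^2$, with faces the components of the complement, such that: (i) every closed face is a closed disk bounded by finitely many edges; (ii) every edge lies in exactly two different closed faces; (iii) two distinct closed faces intersect in the empty set, a single vertex, or the closure of a single edge; all vertex and face degrees (face degree = number of boundary edges) are at least $3$. Infinite means embedded in $\mathbb R^2$. The combinatorial curvature at a vertex $x$ is $\Phi(x)=1-\frac{|x|}{2}+\sum_{\sigma}\frac{1}{|\sigma|}$, summed over faces whose closure contains $x$; non-negative curvature means $\Phi\ge0$ at every vertex. $4$-regular means all vertices have degree $4$. $\partial\sigma$ is the set of vertices in the closure of the face $\sigma$. Two faces are lower-adjacent if their closures contain a common edge. For a face $\sigma$, faces $\tau,\omega$ are $\sigma$-adjacent if both are lower-adjacent to $\sigma$ and $\bar\tau\cap\bar\omega$ is a single vertex lying on $\sigma$. -}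

module Defs where

open import Level using (Level; _⊔_) renaming (suc to lsuc; zero to lzero)
open import Data.Nat as ℕ using (ℕ; zero; suc; _<_; _≤_)
open import Data.Integer using (+_)
open import Data.Rational as ℚ using (ℚ; 0ℚ; 1ℚ)
open import Data.List using (List; []; _∷_; _++_; map; upTo; foldr)
open import Data.List.Membership.Propositional using (_∉_)
open import Data.Product using (Σ; ∃; ∃-syntax; _×_; _,_)
open import Data.Sum using (_⊎_)
open import Relation.Nullary using (¬_)
open import Data.Empty using (⊥)
open import Relation.Binary.PropositionalEquality using (_≡_; _≢_)
open import Relation.Binary.Construct.Closure.Equivalence using (EqClosure)

iter : {A : Set} → (A → A) → ℕ → A → A
iter f zero    a = a
iter f (suc n) a = f (iter f n a)

-- 1/n as a rational (with the harmless convention 1/0 = 0; degrees are ≥ 3)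
recip : ℕ → ℚ
recip zero    = 0ℚ
recip (suc n) = (+ 1) ℚ./ suc n

sumℚ : List ℚ → ℚ
sumℚ = foldr ℚ._+_ 0ℚ

-- A planar tessellation, encoded as a combinatorial map (rotation system).
--
-- Darts D are oriented edges.  α reverses a dart; φ sends a dart to the
-- next dart along the boundary of the face lying on its left.  tail d is
-- the starting vertex of d, fc d the face containing d in its boundary.
-- The vertex rotation is ρ = φ ∘ α (darts leaving the same vertex).

record PreMap : Set₁ where
  field
    V D F : Set
    α φ φ⁻¹ : D → D
    tail : D → V
    fc   : D → F
    out  : V → D
    fd   : F → D
    vdeg : V → ℕ
    fdeg : F → ℕ

  head : D → V
  head d = tail (α d)

  ρ : D → D
  ρ d = φ (α d)

  faceWalk : D → List D
  faceWalk d = map (λ i → iter φ i d) (upTo (fdeg (fc d)))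

  data Chain : V → V → List D → Set where
    nil  : ∀ {v} → Chain v v []
    cons : ∀ {u w d ds} → tail d ≡ u → Chain (head d) w ds → Chain u w (d ∷ ds)

  -- elementary combinatorial homotopies of edge walks:
  -- removing a backtrack, or removing a full face boundary cycle,
  -- inserted at a vertex of the walk
  data Red : List D → List D → Set where
    back : ∀ {u w} xs ys d → Chain u (tail d) xs → Chain (tail d) w ys →
           Red (xs ++ (d ∷ α d ∷ ys)) (xs ++ ys)
    face : ∀ {u w} xs ys d → Chain u (tail d) xs → Chain (tail d) w ys →
           Red (xs ++ (faceWalk d ++ ys)) (xs ++ ys)

  OnFace : V → F → Set
  OnFace v σ = ∃[ d ] (fc d ≡ σ × tail d ≡ v)

  EdgeOn : V → V → F → Set
  EdgeOn u v σ = ∃[ d ] (fc d ≡ σ × ((tail d ≡ u × head d ≡ v) ⊎ (tail d ≡ v × head d ≡ u)))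

record IsPlanarTessellation (M : PreMap) : Set where
  open PreMap M
  field
    α-invol   : ∀ d → α (α d) ≡ d
    φ-inv₁    : ∀ d → φ (φ⁻¹ d) ≡ d
    φ-inv₂    : ∀ d → φ⁻¹ (φ d) ≡ d
    tail-φ    : ∀ d → tail (φ d) ≡ head d
    fc-φ      : ∀ d → fc (φ d) ≡ fc d
    out-tail  : ∀ v → tail (out v) ≡ v
    fd-fc     : ∀ σ → fc (fd σ) ≡ σ
    -- vertices = ρ-orbits, of finite size vdeg (local finiteness)
    vertex-orbit : ∀ d d' → tail d ≡ tail d' → ∃[ n ] iter ρ n d ≡ d'
    vdeg-period  : ∀ d → iter ρ (vdeg (tail d)) d ≡ d
    vdeg-minimal : ∀ d n → 0 < n → n < vdeg (tail d) → iter ρ n d ≢ d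
    -- faces = φ-orbits, bounded by finitely many (fdeg) edges
    face-orbit   : ∀ d d' → fc d ≡ fc d' → ∃[ n ] iter φ n d ≡ d'
    fdeg-period  : ∀ d → iter φ (fdeg (fc d)) d ≡ d
    no-loop      : ∀ d → tail d ≢ head d
    no-multi     : ∀ d d' → tail d ≡ tail d' → head d ≡ head d' → d ≡ d'
    vdeg≥3 : ∀ v → 3 ≤ vdeg v
    fdeg≥3 : ∀ σ → 3 ≤ fdeg σ
    -- (i) each closed face is a closed disk: its boundary walk is a simple cycle
    face-simple : ∀ d i j → i < fdeg (fc d) → j < fdeg (fc d) →
                  tail (iter φ i d) ≡ tail (iter φ j d) → i ≡ j
    -- (ii) every edge lies in exactly two different closed faces
    two-faces : ∀ d → fc d ≢ fc (α d)
    -- (iii) distinct closed faces meet in ∅, one vertex, or the closure of one edge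
    meet-≤2   : ∀ σ τ → σ ≢ τ → ∀ u v w →
                OnFace u σ → OnFace u τ → OnFace v σ → OnFace v τ →
                OnFace w σ → OnFace w τ → u ≢ v → v ≢ w → u ≢ w → ⊥
    meet-edge : ∀ σ τ → σ ≢ τ → ∀ u v →
                OnFace u σ → OnFace u τ → OnFace v σ → OnFace v τ → u ≢ v →
                ∃[ d ] (tail d ≡ u × head d ≡ v ×
                        ((fc d ≡ σ × fc (α d) ≡ τ) ⊎ (fc d ≡ τ × fc (α d) ≡ σ)))
    connected : ∀ u v → ∃[ ds ] Chain u v ds
    -- embedded in ℝ² (not S²): the 2-complex is infinite and simply connected
    infinite  : ∀ (xs : List V) → ∃[ v ] v ∉ xs
    simply-connected : ∀ v ds → Chain v v ds → EqClosure Red ds []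

record PlanarTessellation : Set₁ where
  field
    cmap  : PreMap
    isTes : IsPlanarTessellation cmap
  open PreMap cmap public

module _ (Γ : PlanarTessellation) where
  open PlanarTessellation Γ

  -- combinatorial curvature Φ(x) = 1 - |x|/2 + Σ_{σ ∋ x} 1/|σ|;
  -- the faces containing x are the faces of the darts ρ^i (out x), i < |x|
  curvature : V → ℚ
  curvature x = (1ℚ ℚ.- ((+ vdeg x) ℚ./ 2))
                ℚ.+ sumℚ (map (λ i → recip (fdeg (fc (iter ρ i (out x))))) (upTo (vdeg x)))

  NonNegCurv : Set
  NonNegCurv = ∀ x → 0ℚ ℚ.≤ curvature x

  FourRegular : Set
  FourRegular = ∀ x → vdeg x ≡ 4

  LowerAdj : F → F → Set
  LowerAdj τ σ = ∃[ u ] ∃[ v ] (EdgeOn u v τ × EdgeOn u v σ)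

  Adj[_] : F → F → F → Set
  Adj[ σ ] τ ω = LowerAdj τ σ × LowerAdj ω σ × τ ≢ ω ×
                 ∃[ v ] (OnFace v τ × OnFace v ω × OnFace v σ ×
                         (∀ w → OnFace w τ → OnFace w ω → w ≡ v))

  OnDiff : V → F → F → Set
  OnDiff v τ σ = OnFace v τ × ¬ OnFace v σ

-- In a 4-regular tessellation, non-negative curvature at a vertex says that the reciprocal
-- degrees of its four faces sum to at least 1; in particular no vertex lies on two faces of
-- degree ≥ 8.  The apex x of τ (its vertex off σ₁) is by hypothesis also the apex of ω.  Around
-- x the triangles are neither equal nor consecutive (a shared side would put σ₁ and σ₂ at a
-- common vertex), so they are opposite, and a face γ sits between them, across the side xy of τ.
-- Curvature at y (faces σ₁, τ, γ, ·) forces |γ| ∈ {3, 4}.  If γ is a triangle xyz, the face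
-- across yz is adjacent to σ₁ at y and to σ₂ at z, and it is a square (as a triangle its third
-- corner would lie on σ₁ and σ₂; curvature at y bounds it by 4): alternative (1).  If γ is a square,
-- curvature at y and at z makes the remaining faces there triangles meeting at the fourth corner
-- of γ: alternative (2).

module Submission where

open import Defs
open import Data.Nat using (ℕ; zero; suc; _≤_; _<_; _+_; _*_; z≤n; s≤s; z<s; s<s; NonZero; >-nonZero; >-nonZero⁻¹)
open import Data.Nat.Properties using (<-≤-trans; ≤-reflexive; m≤n⇒m<n∨m≡n)
open import Data.Nat.DivMod using (_%_; _/_; m≡m%n+[m/n]*n; m%n<n)
open import Data.Nat.Coprimality using (1-coprimeTo)
open import Data.Integer as ℤ using (+_)
import Data.Integer.Properties as ℤP
open import Data.Rational as ℚ using (ℚ; 0ℚ; 1ℚ; mkℚ)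
import Data.Rational.Properties as ℚP
open import Data.Rational.Solver using (module +-*-Solver)
open import Data.List using ([]; _∷_; map; upTo)
open import Data.Product using (∃-syntax; _×_; _,_; proj₁; proj₂)
open import Data.Sum using (_⊎_; inj₁; inj₂)
open import Data.Empty using (⊥; ⊥-elim)
open import Relation.Nullary using (¬_; Dec; yes; no)
open import Relation.Nullary.Decidable using (True; toWitness)
open import Relation.Binary.PropositionalEquality
  using (_≡_; _≢_; refl; sym; trans; cong; subst; subst₂; module ≡-Reasoning)

-- Φ at a vertex of degree 4 with faces of degrees a, b, c, e, in the shape of `curvature`.
curv₄ : ℕ → ℕ → ℕ → ℕ → ℚ
curv₄ a b c e = (1ℚ ℚ.- ((+ 4) ℚ./ 2)) ℚ.+ sumℚ (recip a ∷ recip b ∷ recip c ∷ recip e ∷ [])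

curv₄-rotate : ∀ a b c e → curv₄ a b c e ≡ curv₄ b c e a
curv₄-rotate a b c e = cong (1ℚ ℚ.- ((+ 4) ℚ./ 2) ℚ.+_) (sumℚ-rotate (recip a) (recip b) (recip c) (recip e))
  where
  open +-*-Solver
  sumℚ-rotate : ∀ p q r s → sumℚ (p ∷ q ∷ r ∷ s ∷ []) ≡ sumℚ (q ∷ r ∷ s ∷ p ∷ [])
  sumℚ-rotate = solve 4 (λ p q r s → p :+ (q :+ (r :+ (s :+ con 0ℚ)))
                                  := q :+ (r :+ (s :+ (p :+ con 0ℚ)))) refl

recip-suc : ∀ n → recip (suc n) ≡ mkℚ (+ 1) n (1-coprimeTo (suc n))
recip-suc n = ℚP.normalize-coprime (1-coprimeTo (suc n))

recip-antitone : ∀ {m n} → 0 < m → m ≤ n → recip n ℚ.≤ recip m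
recip-antitone {suc m} {suc n} _ m≤n rewrite recip-suc m | recip-suc n =
  ℚ.*≤* (subst₂ ℤ._≤_ (sym (ℤP.*-identityˡ (+ suc m))) (sym (ℤP.*-identityˡ (+ suc n))) (ℤ.+≤+ m≤n))

curv₄-antitone : ∀ {A B C E a b c e} → 0 < A → 0 < B → 0 < C → 0 < E →
                 A ≤ a → B ≤ b → C ≤ c → E ≤ e → curv₄ a b c e ℚ.≤ curv₄ A B C E
curv₄-antitone A>0 B>0 C>0 E>0 A≤a B≤b C≤c E≤e =
  ℚP.+-monoʳ-≤ (1ℚ ℚ.- ((+ 4) ℚ./ 2))
    (ℚP.+-mono-≤ (recip-antitone A>0 A≤a) (ℚP.+-mono-≤ (recip-antitone B>0 B≤b)
      (ℚP.+-mono-≤ (recip-antitone C>0 C≤c) (ℚP.+-mono-≤ (recip-antitone E>0 E≤e) (ℚP.≤-refl {0ℚ})))))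

-- With literal bounds the side condition `negative` is discharged by evaluation.
curv₄-negative-above : ∀ A B C E .{{_ : NonZero A}} .{{_ : NonZero B}} .{{_ : NonZero C}} .{{_ : NonZero E}}
  {a b c e} {negative : True (curv₄ A B C E ℚ.<? 0ℚ)} →
  A ≤ a → B ≤ b → C ≤ c → E ≤ e → ¬ 0ℚ ℚ.≤ curv₄ a b c e
curv₄-negative-above A B C E {negative = negative} A≤a B≤b C≤c E≤e nonneg =
  ℚP.<-irrefl refl (ℚP.≤-<-trans nonneg (ℚP.≤-<-trans
    (curv₄-antitone (>-nonZero⁻¹ A) (>-nonZero⁻¹ B) (>-nonZero⁻¹ C) (>-nonZero⁻¹ E) A≤a B≤b C≤c E≤e)
    (toWitness negative)))

iter-+ : ∀ {A : Set} (f : A → A) m n z → iter f (m + n) z ≡ iter f m (iter f n z)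
iter-+ f zero    n z = refl
iter-+ f (suc m) n z = cong f (iter-+ f m n z)

iter-periodic : ∀ {A : Set} (f : A → A) {k z} → iter f k z ≡ z → ∀ q → iter f (q * k) z ≡ z
iter-periodic f         period zero    = refl
iter-periodic f {k} {z} period (suc q) =
  trans (iter-+ f k (q * k) z) (trans (cong (iter f k) (iter-periodic f period q)) period)

iter-mod : ∀ {A : Set} (f : A → A) {k z} .{{_ : NonZero k}} → iter f k z ≡ z →
           ∀ n → ∃[ r ] (r < k × iter f n z ≡ iter f r z)
iter-mod f {k} {z} period n = n % k , m%n<n n k ,
  trans (cong (λ m → iter f m z) (m≡m%n+[m/n]*n n k))
    (trans (iter-+ f (n % k) ((n / k) * k) z) (cong (iter f (n % k)) (iter-periodic f period (n / k))))

module Tessellation (Γ : PlanarTessellation) where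
  open PlanarTessellation Γ
  open IsPlanarTessellation isTes

  deg : D → ℕ
  deg d = fdeg (fc d)

  apex : D → D
  apex d = φ (φ d)

  deg≥3 : ∀ d → 3 ≤ deg d
  deg≥3 d = fdeg≥3 (fc d)

  deg≡3 : ∀ d → ¬ 4 ≤ deg d → deg d ≡ 3
  deg≡3 d d≱4 with m≤n⇒m<n∨m≡n (deg≥3 d)
  ... | inj₁ d≥4 = ⊥-elim (d≱4 d≥4)
  ... | inj₂ 3≡d = sym 3≡d

  deg-cases : ∀ d → deg d ≡ 3 ⊎ deg d ≡ 4 ⊎ 5 ≤ deg d
  deg-cases d with m≤n⇒m<n∨m≡n (deg≥3 d)
  ... | inj₂ 3≡d = inj₁ (sym 3≡d)
  ... | inj₁ d≥4 with m≤n⇒m<n∨m≡n d≥4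
  ...   | inj₂ 4≡d = inj₂ (inj₁ (sym 4≡d))
  ...   | inj₁ d≥5 = inj₂ (inj₂ d≥5)

  φ-injective : ∀ {d d'} → φ d ≡ φ d' → d ≡ d'
  φ-injective {d} {d'} eq = trans (sym (φ-inv₂ d)) (trans (cong φ⁻¹ eq) (φ-inv₂ d'))

  ρ-α : ∀ d → ρ (α d) ≡ φ d
  ρ-α d = cong φ (α-invol d)

  fc-ρ : ∀ d → fc (ρ d) ≡ fc (α d)
  fc-ρ d = fc-φ (α d)

  tail-ρ : ∀ d → tail (ρ d) ≡ tail d
  tail-ρ d = trans (tail-φ (α d)) (cong tail (α-invol d))

  tail-iterρ : ∀ n d → tail (iter ρ n d) ≡ tail d
  tail-iterρ zero    d = refl
  tail-iterρ (suc n) d = trans (tail-ρ (iter ρ n d)) (tail-iterρ n d)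

  φ-orbit : ∀ d n → ∃[ r ] (r < deg d × iter φ n d ≡ iter φ r d)
  φ-orbit d = iter-mod φ {{>-nonZero (<-≤-trans z<s (deg≥3 d))}} (fdeg-period d)

  φ³-triangle : ∀ {d} → deg d ≡ 3 → φ (φ (φ d)) ≡ d
  φ³-triangle {d} d△ = subst (λ n → iter φ n d ≡ d) d△ (fdeg-period d)

  φ⁴-square : ∀ {d} → deg d ≡ 4 → φ (φ (φ (φ d))) ≡ d
  φ⁴-square {d} d□ = subst (λ n → iter φ n d ≡ d) d□ (fdeg-period d)

  corners-distinct : ∀ d {i j} → i < deg d → j < deg d → i ≢ j → tail (iter φ i d) ≢ tail (iter φ j d)
  corners-distinct d i<k j<k i≢j eq = i≢j (face-simple d _ _ i<k j<k eq)

  dart-unique : ∀ {d d'} → fc d ≡ fc d' → tail d ≡ tail d' → d ≡ d'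
  dart-unique {d} {d'} same-face same-tail with face-orbit d d' same-face
  ... | n , φⁿd≡d' with φ-orbit d n
  ... | r , r<k , φⁿd≡φʳd with face-simple d 0 r (<-≤-trans z<s (deg≥3 d)) r<k
                                 (trans same-tail (cong tail (trans (sym φⁿd≡d') φⁿd≡φʳd)))
  ... | refl = trans (sym φⁿd≡φʳd) φⁿd≡d'

  triangle-darts : ∀ {t d} → deg t ≡ 3 → fc t ≡ fc d → d ≡ t ⊎ d ≡ φ t ⊎ d ≡ apex t
  triangle-darts {t} {d} t△ same-face with face-orbit t d same-face
  ... | n , φⁿt≡d with φ-orbit t n
  ... | r , r<k , φⁿt≡φʳt with subst (r <_) t△ r<k
  ... | s≤s z≤n             = inj₁ (trans (sym φⁿt≡d) φⁿt≡φʳt)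
  ... | s≤s (s≤s z≤n)       = inj₂ (inj₁ (trans (sym φⁿt≡d) φⁿt≡φʳt))
  ... | s≤s (s≤s (s≤s z≤n)) = inj₂ (inj₂ (trans (sym φⁿt≡d) φⁿt≡φʳt))

  tail-on-face-dec : ∀ {w} d → OnFace w (fc d) → Dec (w ≡ tail d)
  tail-on-face-dec {w} d (d' , d'∈ , d'-tail) with face-orbit d d' (sym d'∈)
  ... | n , φⁿd≡d' with φ-orbit d n
  ... | zero  , _   , φⁿd≡d = yes (trans (sym d'-tail) (cong tail (trans (sym φⁿd≡d') φⁿd≡d)))
  ... | suc r , r<k , φⁿd≡φʳd = no λ w≡ →
        corners-distinct d r<k (<-≤-trans z<s (deg≥3 d)) (λ ())
          (trans (cong tail (trans (sym φⁿd≡φʳd) φⁿd≡d')) (trans d'-tail w≡))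

  corner-meet : ∀ {d d'} → tail d ≡ tail d' → fc d ≢ fc d' → fc (α d) ≢ fc d' → fc (α d') ≢ fc d →
                ∀ w → OnFace w (fc d) → OnFace w (fc d') → w ≡ tail d
  corner-meet {d} {d'} same-tail d≢d' αd≢d' αd'≢d w w∈d w∈d' with tail-on-face-dec d w∈d
  ... | yes w≡ = w≡
  ... | no w≢ with meet-edge (fc d) (fc d') d≢d' (tail d) w (d , refl , refl) (d' , refl , sym same-tail)
                     w∈d w∈d' (λ eq → w≢ (sym eq))
  ... | e , e-tail , _ , inj₁ (e∈d , αe∈d') =
          ⊥-elim (αd≢d' (subst (λ x → fc (α x) ≡ fc d') (dart-unique e∈d e-tail) αe∈d'))
  ... | e , e-tail , _ , inj₂ (e∈d' , αe∈d) =
          ⊥-elim (αd'≢d (subst (λ x → fc (α x) ≡ fc d) (dart-unique e∈d' (trans e-tail same-tail)) αe∈d))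

  edge-ends-on : ∀ d → OnFace (tail d) (fc (α d)) × OnFace (tail (φ d)) (fc (α d))
  edge-ends-on d = (ρ d , fc-ρ d , tail-ρ d) ,
                   (α d , refl , sym (tail-φ d))

  apex-off : ∀ {t} → deg t ≡ 3 → OnDiff Γ (tail (apex t)) (fc t) (fc (α t))
  apex-off {t} t△ = apex∈t , λ apex∈αt →
    meet-≤2 (fc t) (fc (α t)) (two-faces t) (tail t) (tail (φ t)) (tail (apex t))
      (t , refl , refl) (proj₁ (edge-ends-on t)) (φ t , fc-φ t , refl) (proj₂ (edge-ends-on t))
      apex∈t apex∈αt (corner≢ z<s (s<s z<s) (λ ())) (corner≢ (s<s z<s) (s<s (s<s z<s)) (λ ()))
      (corner≢ z<s (s<s (s<s z<s)) (λ ()))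
    where
    apex∈t : OnFace (tail (apex t)) (fc t)
    apex∈t = apex t , trans (fc-φ (φ t)) (fc-φ t) , refl
    corner≢ : ∀ {i j} → i < 3 → j < 3 → i ≢ j → tail (iter φ i t) ≢ tail (iter φ j t)
    corner≢ {i} {j} i<3 j<3 = corners-distinct t (subst (i <_) (sym t△) i<3) (subst (j <_) (sym t△) j<3)

  apex-unique : ∀ {t v} → deg t ≡ 3 → OnDiff Γ v (fc t) (fc (α t)) → v ≡ tail (apex t)
  apex-unique {t} t△ ((d , d∈t , d-tail) , v∉αt) with triangle-darts t△ (sym d∈t)
  ... | inj₁ refl        = ⊥-elim (v∉αt (subst (λ x → OnFace x (fc (α t))) d-tail (proj₁ (edge-ends-on t))))
  ... | inj₂ (inj₁ refl) = ⊥-elim (v∉αt (subst (λ x → OnFace x (fc (α t))) d-tail (proj₂ (edge-ends-on t))))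
  ... | inj₂ (inj₂ refl) = sym d-tail

  triangle≢large-face : ∀ {X S} → fdeg X ≡ 3 → 8 ≤ fdeg S → X ≢ S
  triangle≢large-face X△ S≥8 refl with subst (8 ≤_) X△ S≥8
  ... | s≤s (s≤s (s≤s ()))

  crossing-dart : ∀ {X S} → LowerAdj Γ X S → X ≢ S → ∃[ a ] (fc a ≡ X × fc (α a) ≡ S)
  crossing-dart {X} {S} (u , v , (d , d∈X , d-ends) , (d' , d'∈S , d'-ends)) X≢S = orient d-ends d'-ends
    where
    same-dart : ∀ {x y} → tail d ≡ x → head d ≡ y → tail d' ≡ x → head d' ≡ y → ⊥
    same-dart dt dh d't d'h =
      X≢S (trans (sym d∈X) (trans (cong fc (no-multi d d' (trans dt (sym d't)) (trans dh (sym d'h)))) d'∈S))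
    reversed : ∀ {x y} → tail d ≡ x → head d ≡ y → tail d' ≡ y → head d' ≡ x → fc (α d) ≡ S
    reversed dt dh d't d'h =
      trans (cong fc (no-multi (α d) d' (trans dh (sym d't)) (trans (cong tail (α-invol d)) (trans dt (sym d'h)))))
            d'∈S
    orient : (tail d ≡ u × head d ≡ v) ⊎ (tail d ≡ v × head d ≡ u) →
             (tail d' ≡ u × head d' ≡ v) ⊎ (tail d' ≡ v × head d' ≡ u) → ∃[ a ] (fc a ≡ X × fc (α a) ≡ S)
    orient (inj₁ (dt , dh)) (inj₁ (d't , d'h)) = ⊥-elim (same-dart dt dh d't d'h)
    orient (inj₂ (dt , dh)) (inj₂ (d't , d'h)) = ⊥-elim (same-dart dt dh d't d'h)
    orient (inj₁ (dt , dh)) (inj₂ (d't , d'h)) = d , d∈X , reversed dt dh d't d'h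
    orient (inj₂ (dt , dh)) (inj₁ (d't , d'h)) = d , d∈X , reversed dt dh d't d'h

  Adj-sym : ∀ {σ τ ω} → Adj[_] Γ σ τ ω → Adj[_] Γ σ ω τ
  Adj-sym (τ∼σ , ω∼σ , τ≢ω , v , v∈τ , v∈ω , v∈σ , only-v) =
    ω∼σ , τ∼σ , (λ eq → τ≢ω (sym eq)) , v , v∈ω , v∈τ , v∈σ , (λ w w∈ω w∈τ → only-v w w∈τ w∈ω)

  Adj-cong : ∀ {σ τ ω σ' τ' ω'} → σ ≡ σ' → τ ≡ τ' → ω ≡ ω' → Adj[_] Γ σ τ ω → Adj[_] Γ σ' τ' ω'
  Adj-cong refl refl refl adj = adj

  OnDiff-cong : ∀ {v X S v' X' S'} → v ≡ v' → X ≡ X' → S ≡ S' → OnDiff Γ v X S → OnDiff Γ v' X' S'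
  OnDiff-cong refl refl refl off = off

module FourRegularTessellation (Γ : PlanarTessellation) (four-regular : FourRegular Γ) where
  open PlanarTessellation Γ
  open IsPlanarTessellation isTes
  open Tessellation Γ

  ρ⁴≡id : ∀ d → iter ρ 4 d ≡ d
  ρ⁴≡id d = subst (λ n → iter ρ n d ≡ d) (four-regular (tail d)) (vdeg-period d)

  ρ³-apex : ∀ d → iter ρ 3 (apex d) ≡ α (φ d)
  ρ³-apex d = trans (cong (iter ρ 3) (sym (ρ-α (φ d)))) (ρ⁴≡id (α (φ d)))

  darts-at-vertex : ∀ {d d'} → tail d ≡ tail d' → d' ≡ d ⊎ d' ≡ ρ d ⊎ d' ≡ ρ (ρ d) ⊎ d' ≡ iter ρ 3 d
  darts-at-vertex {d} {d'} same-tail with vertex-orbit d d' same-tail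
  ... | n , ρⁿd≡d' with iter-mod ρ {4} (ρ⁴≡id d) n
  ... | 0 , _ , ρⁿd≡ρʳd = inj₁ (trans (sym ρⁿd≡d') ρⁿd≡ρʳd)
  ... | 1 , _ , ρⁿd≡ρʳd = inj₂ (inj₁ (trans (sym ρⁿd≡d') ρⁿd≡ρʳd))
  ... | 2 , _ , ρⁿd≡ρʳd = inj₂ (inj₂ (inj₁ (trans (sym ρⁿd≡d') ρⁿd≡ρʳd)))
  ... | 3 , _ , ρⁿd≡ρʳd = inj₂ (inj₂ (inj₂ (trans (sym ρⁿd≡d') ρⁿd≡ρʳd)))
  ... | suc (suc (suc (suc _))) , s≤s (s≤s (s≤s (s≤s ()))) , _

  ρ-faces-distinct : ∀ d n → 0 < n → n < 4 → fc (iter ρ n d) ≢ fc d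
  ρ-faces-distinct d n n>0 n<4 same-face =
    vdeg-minimal d n n>0 (subst (n <_) (sym (four-regular (tail d))) n<4)
      (dart-unique same-face (tail-iterρ n d))

  fc-α-ρ³ : ∀ d → fc (α (iter ρ 3 d)) ≡ fc d
  fc-α-ρ³ d = trans (sym (fc-φ (α (iter ρ 3 d)))) (cong fc (ρ⁴≡id d))

  ρ-neighbours-adjacent : ∀ d → Adj[_] Γ (fc d) (fc (iter ρ 3 d)) (fc (ρ d))
  ρ-neighbours-adjacent d =
    ρ³d∼d , ρd∼d , ρ³d≢ρd ,
    tail d , (ρ³d , refl , tail-iterρ 3 d) , (ρ d , refl , tail-ρ d) , (d , refl , refl) ,
    λ w w∈ρ³d w∈ρd →
      trans (corner-meet (trans (tail-iterρ 3 d) (sym (tail-ρ d))) ρ³d≢ρd αρ³d≢ρd αρd≢ρ³d w w∈ρ³d w∈ρd)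
            (tail-iterρ 3 d)
    where
    ρ³d = iter ρ 3 d
    ρ³d∼d : LowerAdj Γ (fc ρ³d) (fc d)
    ρ³d∼d = tail ρ³d , head ρ³d , (ρ³d , refl , inj₁ (refl , refl)) ,
            (α ρ³d , fc-α-ρ³ d , inj₂ (refl , cong tail (α-invol ρ³d)))
    ρd∼d : LowerAdj Γ (fc (ρ d)) (fc d)
    ρd∼d = tail d , head d , (α d , sym (fc-ρ d) , inj₂ (refl , cong tail (α-invol d))) ,
           (d , refl , inj₁ (refl , refl))
    ρ³d≢ρd : fc ρ³d ≢ fc (ρ d)
    ρ³d≢ρd = ρ-faces-distinct (ρ d) 2 z<s (s<s (s<s z<s))
    αρ³d≢ρd : fc (α ρ³d) ≢ fc (ρ d)
    αρ³d≢ρd eq = ρ-faces-distinct d 1 z<s (s<s z<s) (trans (sym eq) (fc-α-ρ³ d))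
    αρd≢ρ³d : fc (α (ρ d)) ≢ fc ρ³d
    αρd≢ρ³d eq = ρ-faces-distinct (ρ (ρ d)) 1 z<s (s<s z<s) (sym (trans (fc-ρ (ρ d)) eq))

module NonNegativeCurvature
  (Γ : PlanarTessellation) (four-regular : FourRegular Γ) (nonneg : NonNegCurv Γ) where
  open PlanarTessellation Γ
  open IsPlanarTessellation isTes
  open Tessellation Γ
  open FourRegularTessellation Γ four-regular

  NonNegAt : D → Set
  NonNegAt d = 0ℚ ℚ.≤ curv₄ (deg d) (deg (ρ d)) (deg (ρ (ρ d))) (deg (iter ρ 3 d))

  nonneg-at-out : ∀ x → NonNegAt (out x)
  nonneg-at-out x = subst (λ n → 0ℚ ℚ.≤ (1ℚ ℚ.- ((+ n) ℚ./ 2))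
                                   ℚ.+ sumℚ (map (λ i → recip (deg (iter ρ i (out x)))) (upTo n)))
                          (four-regular x) (nonneg x)

  NonNegAt-ρ : ∀ {d} → NonNegAt d → NonNegAt (ρ d)
  NonNegAt-ρ {d} nonneg-d =
    subst (λ x → 0ℚ ℚ.≤ curv₄ (deg (ρ d)) (deg (ρ (ρ d))) (deg (iter ρ 3 d)) (deg x)) (sym (ρ⁴≡id d))
      (subst (0ℚ ℚ.≤_) (curv₄-rotate (deg d) (deg (ρ d)) (deg (ρ (ρ d))) (deg (iter ρ 3 d))) nonneg-d)

  nonneg-at : ∀ d → NonNegAt d
  nonneg-at d with vertex-orbit (out (tail d)) d (out-tail (tail d))
  ... | n , ρⁿout≡d = subst NonNegAt ρⁿout≡d (along-rotation n)
    where
    along-rotation : ∀ n → NonNegAt (iter ρ n (out (tail d)))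
    along-rotation zero    = nonneg-at-out (tail d)
    along-rotation (suc n) = NonNegAt-ρ (along-rotation n)

  large-face-unique : ∀ {d d'} → tail d ≡ tail d' → 8 ≤ deg d → 8 ≤ deg d' → d' ≡ d
  large-face-unique {d} {d'} same-tail d≥8 d'≥8 with darts-at-vertex same-tail
  ... | inj₁ d'≡d = d'≡d
  ... | inj₂ (inj₁ refl) =
    ⊥-elim (curv₄-negative-above 8 8 3 3 d≥8 d'≥8 (deg≥3 _) (deg≥3 _) (nonneg-at d))
  ... | inj₂ (inj₂ (inj₁ refl)) =
    ⊥-elim (curv₄-negative-above 8 3 8 3 d≥8 (deg≥3 _) d'≥8 (deg≥3 _) (nonneg-at d))
  ... | inj₂ (inj₂ (inj₂ refl)) =
    ⊥-elim (curv₄-negative-above 8 3 3 8 d≥8 (deg≥3 _) (deg≥3 _) d'≥8 (nonneg-at d))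

module TrianglesOnLargeFaces
  (Γ : PlanarTessellation) (four-regular : FourRegular Γ) (nonneg : NonNegCurv Γ) where
  open PlanarTessellation Γ
  open IsPlanarTessellation isTes
  open Tessellation Γ
  open FourRegularTessellation Γ four-regular
  open NonNegativeCurvature Γ four-regular nonneg

  SquareBridge : F → F → F → F → Set
  SquareBridge σ₁ σ₂ τ ω = ∃[ ω₁ ] (fdeg ω₁ ≡ 4 × Adj[_] Γ σ₁ ω₁ τ × Adj[_] Γ σ₂ ω₁ ω)

  TriangleBridge : F → F → F → F → Set
  TriangleBridge σ₁ σ₂ τ ω = ∃[ τ₁ ] ∃[ ω₁ ] (fdeg τ₁ ≡ 3 × fdeg ω₁ ≡ 3 ×
    Adj[_] Γ σ₁ τ₁ τ × Adj[_] Γ σ₂ ω₁ ω × ∃[ v ] (OnDiff Γ v τ₁ σ₁ × OnDiff Γ v ω₁ σ₂))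

  no-shared-side : ∀ {a b} → deg b ≡ 3 → 8 ≤ deg (α a) → 8 ≤ deg (α b) → fc (α a) ≢ fc (α b) →
                   apex b ≢ α (φ a)
  no-shared-side {a} {b} b△ σ₁≥8 σ₂≥8 σ₁≢σ₂ shared =
    σ₁≢σ₂ (trans (cong fc (sym ρb≡αa)) (fc-ρ b))
    where
    same-tail : tail (α a) ≡ tail (ρ b)
    same-tail = begin
      tail (α a)            ≡⟨ sym (tail-φ a) ⟩
      tail (φ a)            ≡⟨ cong tail (sym (α-invol (φ a))) ⟩
      head (α (φ a))        ≡⟨ cong head (sym shared) ⟩
      head (apex b)         ≡⟨ sym (tail-φ (apex b)) ⟩
      tail (φ (apex b))     ≡⟨ cong tail (φ³-triangle b△) ⟩
      tail b                ≡⟨ sym (tail-ρ b) ⟩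
      tail (ρ b)            ∎
      where open ≡-Reasoning
    ρb≡αa : ρ b ≡ α a
    ρb≡αa = large-face-unique same-tail σ₁≥8 (subst (8 ≤_) (cong fdeg (sym (fc-ρ b))) σ₂≥8)

  Bridge : F → F → F → F → Set
  Bridge σ₁ σ₂ τ ω = SquareBridge σ₁ σ₂ τ ω ⊎ TriangleBridge σ₁ σ₂ τ ω

  module OppositeApexes {a b : D} (b△ : deg b ≡ 3) (σ₁≥8 : 8 ≤ deg (α a)) (σ₂≥8 : 8 ≤ deg (α b))
                        (σ₁≢σ₂ : fc (α a) ≢ fc (α b)) (opposite : apex b ≡ ρ (ρ (apex a))) where

    -- With x the common apex, y = head a and z = tail b: the darts at y are α a, φ a, e, g,
    -- the face γ = fc e lies between τ and ω at x, and c is the side of γ from z to x.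

    e g c : D
    e = ρ (ρ (α a))
    g = ρ e
    c = α (apex b)

    e≡ρφa : e ≡ ρ (φ a)
    e≡ρφa = cong ρ (ρ-α a)

    ρc≡b : ρ c ≡ b
    ρc≡b = trans (ρ-α (apex b)) (φ³-triangle b△)

    ρ³b≡c : iter ρ 3 b ≡ c
    ρ³b≡c = trans (cong (iter ρ 3) (sym ρc≡b)) (ρ⁴≡id c)

    φφc≡e : φ (φ c) ≡ e
    φφc≡e = trans (cong φ (trans (cong ρ opposite) (ρ³-apex a))) (sym e≡ρφa)

    fc-c≡fc-e : fc c ≡ fc e
    fc-c≡fc-e = trans (sym (fc-φ c)) (trans (sym (fc-φ (φ c))) (cong fc φφc≡e))

    σ₁-adjacency : Adj[_] Γ (fc (α a)) (fc g) (fc a)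
    σ₁-adjacency = Adj-cong refl refl (trans (cong fc (ρ-α a)) (fc-φ a)) (ρ-neighbours-adjacent (α a))

    σ₂-adjacency : Adj[_] Γ (fc (α b)) (fc (ρ (ρ b))) (fc b)
    σ₂-adjacency = Adj-cong (fc-ρ b) refl (cong fc (ρ⁴≡id b)) (Adj-sym (ρ-neighbours-adjacent (ρ b)))

    ρρb≡αe : deg e ≡ 3 → ρ (ρ b) ≡ α e
    ρρb≡αe e△ = trans (sym (α-invol (ρ (ρ b)))) (cong α (φ-injective (trans ρ³b≡c (sym φe≡c))))
      where
      φe≡c : φ e ≡ c
      φe≡c = trans (cong φ (sym φφc≡e)) (φ³-triangle (trans (cong fdeg fc-c≡fc-e) e△))

    triangular-gap : deg e ≡ 3 → SquareBridge (fc (α a)) (fc (α b)) (fc a) (fc b)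
    triangular-gap e△ with deg-cases (α e)
    ... | inj₂ (inj₁ αe□) =
      fc (α e) , αe□ , Adj-cong refl (fc-ρ e) refl σ₁-adjacency ,
      Adj-cong refl (cong fc (ρρb≡αe e△)) refl σ₂-adjacency
    ... | inj₂ (inj₂ αe≥5) = ⊥-elim (curv₄-negative-above 8 3 3 5 σ₁≥8 (deg≥3 _) (deg≥3 _)
                               (subst (5 ≤_) (cong fdeg (sym (fc-ρ e))) αe≥5) (nonneg-at (α a)))
    ... | inj₁ αe△ = ⊥-elim (σ₁≢σ₂ (trans (sym (fc-α-ρ³ (α a))) (trans (cong fc (sym φρb≡αg)) φρb∈σ₂)))
      where
      αρb≡φg : α (ρ b) ≡ φ g
      αρb≡φg = φ-injective (trans (ρρb≡αe e△) (sym (φ³-triangle αe△)))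
      φρb∈σ₂ : fc (φ (ρ b)) ≡ fc (α b)
      φρb∈σ₂ = trans (fc-φ (ρ b)) (fc-ρ b)
      same-tail : tail (α g) ≡ tail (φ (ρ b))
      same-tail = trans (sym (tail-φ g)) (trans (cong tail (sym αρb≡φg)) (sym (tail-φ (ρ b))))
      φρb≡αg : φ (ρ b) ≡ α g
      φρb≡αg = large-face-unique same-tail (subst (8 ≤_) (cong fdeg (sym (fc-α-ρ³ (α a)))) σ₁≥8)
                                           (subst (8 ≤_) (cong fdeg (sym φρb∈σ₂)) σ₂≥8)

    square-gap : deg e ≡ 4 → TriangleBridge (fc (α a)) (fc (α b)) (fc a) (fc b)
    square-gap e□ =
      fc g , fc (ρ (ρ b)) , g△ , ρρb△ , σ₁-adjacency , σ₂-adjacency , tail (α e) , off-σ₁ , off-σ₂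
      where
      c□ : deg c ≡ 4
      c□ = trans (cong fdeg fc-c≡fc-e) e□
      αρρb≡φe : α (ρ (ρ b)) ≡ φ e
      αρρb≡φe = φ-injective (trans ρ³b≡c (sym (trans (cong (λ x → φ (φ x)) (sym φφc≡e)) (φ⁴-square c□))))
      g△ : deg g ≡ 3
      g△ = deg≡3 g λ g≥4 →
        curv₄-negative-above 8 3 4 4 σ₁≥8 (deg≥3 _) (≤-reflexive (sym e□)) g≥4 (nonneg-at (α a))
      ρρb△ : deg (ρ (ρ b)) ≡ 3
      ρρb△ = deg≡3 (ρ (ρ b)) λ ρρb≥4 →
        curv₄-negative-above 3 8 4 4 (deg≥3 b) (subst (8 ≤_) (cong fdeg (sym (fc-ρ b))) σ₂≥8) ρρb≥4
          (≤-reflexive (sym (trans (cong deg ρ³b≡c) c□))) (nonneg-at b)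
      off-σ₁ : OnDiff Γ (tail (α e)) (fc g) (fc (α a))
      off-σ₁ = OnDiff-cong (cong tail (φ³-triangle (trans (cong fdeg (sym (fc-ρ e))) g△))) refl
                 (fc-α-ρ³ (α a)) (apex-off g△)
      off-σ₂ : OnDiff Γ (tail (α e)) (fc (ρ (ρ b))) (fc (α b))
      off-σ₂ = OnDiff-cong (trans (tail-φ (ρ (ρ b))) (trans (cong tail αρρb≡φe) (tail-φ e)))
                 (sym (fc-φ (α (ρ b)))) (trans (cong fc (α-invol (ρ b))) (fc-ρ b))
                 (apex-off (trans (cong fdeg (sym (fc-φ (α (ρ b))))) ρρb△))

    bridge : Bridge (fc (α a)) (fc (α b)) (fc a) (fc b)
    bridge with deg-cases e
    ... | inj₁ e△         = inj₁ (triangular-gap e△)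
    ... | inj₂ (inj₁ e□)  = inj₂ (square-gap e□)
    ... | inj₂ (inj₂ e≥5) =
      ⊥-elim (curv₄-negative-above 8 3 5 3 σ₁≥8 (deg≥3 _) e≥5 (deg≥3 _) (nonneg-at (α a)))

  bridge-at-common-apex : ∀ {a b} → deg a ≡ 3 → deg b ≡ 3 → 8 ≤ deg (α a) → 8 ≤ deg (α b) →
    fc (α a) ≢ fc (α b) → tail (apex a) ≡ tail (apex b) → Bridge (fc (α a)) (fc (α b)) (fc a) (fc b)
  bridge-at-common-apex {a} {b} a△ b△ σ₁≥8 σ₂≥8 σ₁≢σ₂ common with darts-at-vertex common
  ... | inj₁ same =
    ⊥-elim (σ₁≢σ₂ (cong (λ d → fc (α d)) (sym (φ-injective (φ-injective same)))))
  ... | inj₂ (inj₁ next) =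
    ⊥-elim (no-shared-side a△ σ₂≥8 σ₁≥8 (λ eq → σ₁≢σ₂ (sym eq))
             (trans (sym (α-invol (apex a))) (cong α (φ-injective (sym next)))))
  ... | inj₂ (inj₂ (inj₁ opposite)) = OppositeApexes.bridge b△ σ₁≥8 σ₂≥8 σ₁≢σ₂ opposite
  ... | inj₂ (inj₂ (inj₂ previous)) =
    ⊥-elim (no-shared-side b△ σ₁≥8 σ₂≥8 σ₁≢σ₂ (trans previous (ρ³-apex a)))

open Tessellation using (crossing-dart; triangle≢large-face; apex-off; apex-unique)
open TrianglesOnLargeFaces using (bridge-at-common-apex)

lemma4p5 : (Γ : PlanarTessellation) → FourRegular Γ → NonNegCurv Γ →
    let open PlanarTessellation Γ in
    (σ₁ σ₂ τ ω : F) → σ₁ ≢ σ₂ → 8 ≤ fdeg σ₁ → 8 ≤ fdeg σ₂ →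
    fdeg τ ≡ 3 → fdeg ω ≡ 3 → LowerAdj Γ τ σ₁ → LowerAdj Γ ω σ₂ →
    (∀ v → OnDiff Γ v τ σ₁ → OnDiff Γ v ω σ₂) →
    (∀ v → OnDiff Γ v ω σ₂ → OnDiff Γ v τ σ₁) →
    (∃[ ω₁ ] (fdeg ω₁ ≡ 4 × Adj[_] Γ σ₁ ω₁ τ × Adj[_] Γ σ₂ ω₁ ω))
    ⊎ (∃[ τ₁ ] ∃[ ω₁ ] (fdeg τ₁ ≡ 3 × fdeg ω₁ ≡ 3 ×
    Adj[_] Γ σ₁ τ₁ τ × Adj[_] Γ σ₂ ω₁ ω ×
    ∃[ v ] (OnDiff Γ v τ₁ σ₁ × OnDiff Γ v ω₁ σ₂)))
-- Only the inclusion of the apex of τ into ∂ω ∖ ∂σ₂ is needed.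
lemma4p5 Γ four-regular nonneg σ₁ σ₂ τ ω σ₁≢σ₂ σ₁≥8 σ₂≥8 τ△ ω△ τ∼σ₁ ω∼σ₂ τ⊆ω _
  with crossing-dart Γ τ∼σ₁ (triangle≢large-face Γ τ△ σ₁≥8)
     | crossing-dart Γ ω∼σ₂ (triangle≢large-face Γ ω△ σ₂≥8)
... | a , refl , refl | b , refl , refl =
  bridge-at-common-apex Γ four-regular nonneg τ△ ω△ σ₁≥8 σ₂≥8 σ₁≢σ₂
    (apex-unique Γ ω△ (τ⊆ω _ (apex-off Γ τ△)))
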